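{- Let $\Gamma=\mathrm{WH}_n(a,b,c,d)$ be a vertex-transitive Woolly Hat graph such that $n$ is even, $b,d\neq 0$, $2a=d-b$, the $2$-part of $\gcd(c,n)$ exceeds that of $\gcd(a,n)$ (so $c$ is even), and the two $\mathrm{Aut}(\Gamma)$-orbits on edges are the set of all left, right and $c$-edges and the set of all $a$-, $b$- and $d$-edges. If $2c=3a+3b$ in $\mathbb{Z}_n$, then $a$, $b$ and $d$ are all odd; consequently $n,a,b,c,d$ satisfy: $n$ even, $a,b,d$ odd, $c$ even, $d=2a+b$ and $2c=3a+3b$.
   Context: For an integer $n\ge 3$ and $a,b,c,d\in\mathbb{Z}_n$ with $2a\neq 0$, $b,c,d$ pairwise distinct, and such that no prime divides $n$ together with (integer representatives of) all of $a,b,c,d$, the Woolly Hat graph $\mathrm{WH}_n(a,b,c,d)$ is the graph with vertex set $\{A_i,B_i,C_i : i\in\mathbb{Z}_n\}$ with adjacencies, for each $i\in\mathbb{Z}_n$ (subscripts mod $n$): $A_i\sim A_{i-a},A_{i+a},B_i,C_i$; $B_i\sim A_i,C_{i+b},C_{i+c},C_{i+d}$; $C_i\sim A_i,B_{i-b},B_{i-c},B_{i-d}$. The $a$-edges are $A_iA_{i+a}$, the left edges $A_iB_i$, the right edges $A_iC_i$, and for $x\in\{b,c,d\}$ the $x$-edges are $B_iC_{i+x}$. For $n$ even, parity of an element of $\mathbb{Z}_n$ is that of any representative. The $2$-part of a positive integer is the largest power of $2$ dividing it. -}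

module Defs where

open import Data.Nat using (ℕ; zero; suc; _+_; _*_; _∸_; _^_; _<_; _≤_; NonZero)
open import Data.Nat.DivMod using (_%_; _mod_)
open import Data.Nat.Divisibility using (_∣_)
open import Data.Nat.GCD using (gcd)
open import Data.Nat.Primality using (Prime)
open import Data.Fin using (Fin; toℕ)
open import Data.Product using (Σ; _×_; ∃; ∃-syntax; _,_)
open import Data.Sum using (_⊎_)
open import Relation.Binary.PropositionalEquality using (_≡_; _≢_)
open import Relation.Nullary using (¬_)

-- ℤ_n is represented by Fin n (canonical representatives 0..n-1).

module _ {n : ℕ} .{{_ : NonZero n}} where

  _⊕_ : Fin n → Fin n → Fin n
  i ⊕ j = (toℕ i + toℕ j) mod n

  _⊖_ : Fin n → Fin n → Fin n
  i ⊖ j = (toℕ i + (n ∸ toℕ j)) mod n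

  _·_ : ℕ → Fin n → Fin n
  k · x = (k * toℕ x) mod n

  ZeroZ : Fin n → Set
  ZeroZ x = toℕ x ≡ 0

-- parity of an element of ℤ_n (n even): parity of its representative
EvenZ : {n : ℕ} → Fin n → Set
EvenZ x = 2 ∣ toℕ x

OddZ : {n : ℕ} → Fin n → Set
OddZ x = ¬ (2 ∣ toℕ x)

IsTwoPart : ℕ → ℕ → Set
IsTwoPart m p = (∃[ k ] p ≡ 2 ^ k) × p ∣ m × ¬ (2 * p ∣ m)

data Kind : Set where
  KA KB KC : Kind

Vertex : ℕ → Set
Vertex n = Kind × Fin n

data EdgeType : Set where
  aE leftE rightE bE cE dE : EdgeType

module WoollyHat (n : ℕ) .{{_ : NonZero n}} (a b c d : Fin n) where

  -- Gen t u v : {u,v} is an edge of type t, written in a fixed orientation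
  data Gen : EdgeType → Vertex n → Vertex n → Set where
    genA     : ∀ i → Gen aE     (KA , i) (KA , i ⊕ a)
    genLeft  : ∀ i → Gen leftE  (KA , i) (KB , i)
    genRight : ∀ i → Gen rightE (KA , i) (KC , i)
    genB     : ∀ i → Gen bE     (KB , i) (KC , i ⊕ b)
    genC     : ∀ i → Gen cE     (KB , i) (KC , i ⊕ c)
    genD     : ∀ i → Gen dE     (KB , i) (KC , i ⊕ d)

  EdgeOf : EdgeType → Vertex n → Vertex n → Set
  EdgeOf t u v = Gen t u v ⊎ Gen t v u

  Adj : Vertex n → Vertex n → Set
  Adj u v = Σ EdgeType λ t → EdgeOf t u v

  record IsAut (φ : Vertex n → Vertex n) : Set where
    field
      inv      : Vertex n → Vertex n
      inv-left : ∀ v → inv (φ v) ≡ v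
      inv-right : ∀ v → φ (inv v) ≡ v
      adj⇒     : ∀ u v → Adj u v → Adj (φ u) (φ v)
      adj⇐     : ∀ u v → Adj (φ u) (φ v) → Adj u v

  VertexTransitive : Set
  VertexTransitive = ∀ u v → ∃[ φ ] (IsAut φ × φ u ≡ v)

  MapsEdge : (Vertex n → Vertex n) → Vertex n → Vertex n → Vertex n → Vertex n → Set
  MapsEdge φ u v u' v' = (φ u ≡ u' × φ v ≡ v') ⊎ (φ u ≡ v' × φ v ≡ u')

  Class1 : Vertex n → Vertex n → Set
  Class1 u v = EdgeOf leftE u v ⊎ EdgeOf rightE u v ⊎ EdgeOf cE u v

  Class2 : Vertex n → Vertex n → Set
  Class2 u v = EdgeOf aE u v ⊎ EdgeOf bE u v ⊎ EdgeOf dE u v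

  -- the Aut-orbits on edges are exactly Class1 and Class2:
  -- each class lies in a single orbit, and no automorphism maps an
  -- edge of Class1 to an edge of Class2.
  EdgeOrbitsAreClasses : Set
  EdgeOrbitsAreClasses =
      (∀ u v u' v' → Class1 u v → Class1 u' v' →
         ∃[ φ ] (IsAut φ × MapsEdge φ u v u' v'))
    × (∀ u v u' v' → Class2 u v → Class2 u' v' →
         ∃[ φ ] (IsAut φ × MapsEdge φ u v u' v'))
    × (∀ φ → IsAut φ → ∀ u v → Class1 u v → ¬ Class2 (φ u) (φ v))

-- standing admissibility conditions on the parameters of WH_n(a,b,c,d)
WHParams : (n : ℕ) .{{_ : NonZero n}} → Fin n → Fin n → Fin n → Fin n → Set
WHParams n a b c d =
    3 ≤ n
  × ¬ ZeroZ (2 · a)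
  × b ≢ c × b ≢ d × c ≢ d
  × (∀ p → Prime p → p ∣ n → p ∣ toℕ a → p ∣ toℕ b → p ∣ toℕ c → ¬ (p ∣ toℕ d))

{-# OPTIONS --safe #-}
module Submission where

-- Since n is even, parity is well defined on ℤ_n. The hypothesis on 2-parts forces c to be
-- even. Reducing 2c = 3a + 3b and d = 2a + b mod 2 shows that a, b and d have a common
-- parity; were it even, 2 would divide n, a, b, c and d, contradicting the admissibility
-- of the parameters.

open import Defs
open import Data.Nat using (ℕ; _<_; NonZero; zero; suc; _*_; _+_; _∸_; _^_; z<s; s<s; ≢-nonZero⁻¹)
open import Data.Nat.Properties using (m^n>0; m<m*n; *-comm; +-comm; +-assoc; ≤-<-trans; <-irrefl; n≢0⇒n>0; <⇒≤; m∸n+n≡m)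
open import Data.Nat.DivMod using (_%_; _mod_; m%n<n; %-distribˡ-+; [m+n]%n≡m%n; m<n⇒m%n≡m)
open import Data.Nat.Divisibility
open import Data.Nat.GCD using (gcd; gcd[m,n]∣m; gcd[m,n]≢0)
open import Data.Nat.Induction using (<-rec)
open import Data.Nat.Primality using (prime[2]; euclidsLemma)
open import Data.Fin using (Fin; toℕ)
open import Data.Fin.Properties using (toℕ-fromℕ<; toℕ<n; toℕ-injective)
open import Data.Product using (_×_; _,_; ∃)
open import Data.Sum using (inj₁; inj₂)
open import Function using (_∘_)
open import Relation.Binary.PropositionalEquality
open import Relation.Nullary using (¬_; yes; no; contradiction)
open import Relation.Nullary.Decidable using (from-no)

IsTwoPart-odd : ∀ {m} → ¬ 2 ∣ m → IsTwoPart m 1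
IsTwoPart-odd {m} 2∤m = (0 , refl) , 1∣ m , 2∤m

IsTwoPart-*2 : ∀ {m p} → IsTwoPart m p → IsTwoPart (2 * m) (2 * p)
IsTwoPart-*2 ((k , p≡2^k) , p∣m , 2p∤m) =
  (suc k , cong (2 *_) p≡2^k) , *-monoʳ-∣ 2 p∣m , 2p∤m ∘ *-cancelˡ-∣ 2

twoPart : ∀ m → 0 < m → ∃ (IsTwoPart m)
twoPart = <-rec _ step
  where
  step : ∀ m → (∀ {q} → q < m → 0 < q → ∃ (IsTwoPart q)) → 0 < m → ∃ (IsTwoPart m)
  step m rec 0<m with 2 ∣? m
  ... | no 2∤m = 1 , IsTwoPart-odd 2∤m
  ... | yes (divides zero refl) = contradiction 0<m (<-irrefl refl)
  ... | yes (divides q@(suc _) refl) with rec (m<m*n q 2 (s<s z<s)) z<s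
  ...   | p , tp = 2 * p , subst (λ x → IsTwoPart x (2 * p)) (*-comm 2 q) (IsTwoPart-*2 tp)

IsTwoPart>1⇒even : ∀ {m p} → IsTwoPart m p → 1 < p → 2 ∣ m
IsTwoPart>1⇒even ((zero , refl) , _) 1<1 = contradiction 1<1 (<-irrefl refl)
IsTwoPart>1⇒even ((suc k , refl) , p∣m , _) _ = ∣-trans (m∣m*n (2 ^ k)) p∣m

twoPart-dominates⇒even : ∀ {m m′} → 0 < m → 0 < m′ →
  (∀ p q → IsTwoPart m p → IsTwoPart m′ q → q < p) → 2 ∣ m
twoPart-dominates⇒even {m} {m′} 0<m 0<m′ q<p
  with twoPart m 0<m | twoPart m′ 0<m′
... | p , tp | q , tq@((j , refl) , _) =
  IsTwoPart>1⇒even tp (≤-<-trans (m^n>0 2 j) (q<p p q tp tq))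

module _ {n : ℕ} .{{_ : NonZero n}} where

  toℕ-mod : ∀ m → toℕ (m mod n) ≡ m % n
  toℕ-mod m = toℕ-fromℕ< (m%n<n m n)

  ⊖-⊕-cancel : ∀ (x y : Fin n) → (x ⊖ y) ⊕ y ≡ x
  ⊖-⊕-cancel x y = toℕ-injective (begin
    toℕ ((x ⊖ y) ⊕ y)                  ≡⟨ toℕ-mod _ ⟩
    (toℕ (x ⊖ y) + Y) % n              ≡⟨ cong (λ z → (z + Y) % n) (toℕ-mod _) ⟩
    ((X + (n ∸ Y)) % n + Y) % n        ≡⟨ cong (λ z → ((X + (n ∸ Y)) % n + z) % n) (sym (m<n⇒m%n≡m (toℕ<n y))) ⟩
    ((X + (n ∸ Y)) % n + Y % n) % n    ≡⟨ sym (%-distribˡ-+ (X + (n ∸ Y)) Y n) ⟩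
    (X + (n ∸ Y) + Y) % n              ≡⟨ cong (_% n) (+-assoc X (n ∸ Y) Y) ⟩
    (X + ((n ∸ Y) + Y)) % n            ≡⟨ cong (λ z → (X + z) % n) (m∸n+n≡m (<⇒≤ (toℕ<n y))) ⟩
    (X + n) % n                        ≡⟨ [m+n]%n≡m%n X n ⟩
    X % n                              ≡⟨ m<n⇒m%n≡m (toℕ<n x) ⟩
    X                                  ∎)
    where
    open ≡-Reasoning
    X = toℕ x
    Y = toℕ y

  module Parity (2∣n : 2 ∣ n) where

    even-mod : ∀ {m} → 2 ∣ m → EvenZ (m mod n)
    even-mod {m} 2∣m = subst (2 ∣_) (sym (toℕ-mod m)) (%-presˡ-∣ 2∣m 2∣n)

    even-mod⁻¹ : ∀ {m} → EvenZ (m mod n) → 2 ∣ m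
    even-mod⁻¹ {m} 2∣m%n = ∣n∣m%n⇒∣m 2∣n (subst (2 ∣_) (toℕ-mod m) 2∣m%n)

    even-⊕ : ∀ {x y : Fin n} → EvenZ x → EvenZ y → EvenZ (x ⊕ y)
    even-⊕ 2∣x 2∣y = even-mod (∣m∣n⇒∣m+n 2∣x 2∣y)

    even-⊕-cancelˡ : ∀ {x y : Fin n} → EvenZ x → EvenZ (x ⊕ y) → EvenZ y
    even-⊕-cancelˡ 2∣x 2∣x⊕y = ∣m+n∣m⇒∣n (even-mod⁻¹ 2∣x⊕y) 2∣x

    even-⊕-cancelʳ : ∀ {x y : Fin n} → EvenZ y → EvenZ (x ⊕ y) → EvenZ x
    even-⊕-cancelʳ {x} {y} 2∣y 2∣x⊕y =
      ∣m+n∣m⇒∣n (subst (2 ∣_) (+-comm (toℕ x) (toℕ y)) (even-mod⁻¹ 2∣x⊕y)) 2∣y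

    even-2· : ∀ (x : Fin n) → EvenZ (2 · x)
    even-2· x = even-mod (m∣m*n (toℕ x))

    even-·even : ∀ k {x : Fin n} → EvenZ x → EvenZ (k · x)
    even-·even k 2∣x = even-mod (∣-trans 2∣x (n∣m*n k))

    even-odd·⁻¹ : ∀ {k} {x : Fin n} → ¬ 2 ∣ k → EvenZ (k · x) → EvenZ x
    even-odd·⁻¹ {k} {x} 2∤k 2∣kx with euclidsLemma k (toℕ x) prime[2] (even-mod⁻¹ 2∣kx)
    ... | inj₁ 2∣k = contradiction 2∣k 2∤k
    ... | inj₂ 2∣x = 2∣x

proposition4p6 : (n : ℕ) .{{_ : NonZero n}} (a b c d : Fin n) →
    WHParams n a b c d →
    WoollyHat.VertexTransitive n a b c d →
    2 ∣ n →
    ¬ ZeroZ b → ¬ ZeroZ d →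
    2 · a ≡ d ⊖ b →
    (∀ p q → IsTwoPart (gcd (toℕ c) n) p → IsTwoPart (gcd (toℕ a) n) q → q < p) →
    WoollyHat.EdgeOrbitsAreClasses n a b c d →
    2 · c ≡ (3 · a) ⊕ (3 · b) →
    (OddZ a × OddZ b × OddZ d)
      × (2 ∣ n × OddZ a × OddZ b × OddZ d × EvenZ c
         × d ≡ (2 · a) ⊕ b × 2 · c ≡ (3 · a) ⊕ (3 · b))
proposition4p6 n a b c d (_ , _ , _ , _ , _ , coprime) _ 2∣n _ _ 2a≡d-b twoParts _ 2c≡3a+3b =
  (a-odd , b-odd , d-odd) , (2∣n , a-odd , b-odd , d-odd , c-even , d≡2a+b , 2c≡3a+3b)
  where
  open Parity 2∣n

  gcd-pos : ∀ m → 0 < gcd m n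
  gcd-pos m = n≢0⇒n>0 (gcd[m,n]≢0 m n (inj₂ (≢-nonZero⁻¹ n)))

  c-even : EvenZ c
  c-even = ∣-trans (twoPart-dominates⇒even (gcd-pos (toℕ c)) (gcd-pos (toℕ a)) twoParts)
                   (gcd[m,n]∣m (toℕ c) n)

  d≡2a+b : d ≡ (2 · a) ⊕ b
  d≡2a+b = trans (sym (⊖-⊕-cancel d b)) (cong (_⊕ b) (sym 2a≡d-b))

  3a+3b-even : EvenZ ((3 · a) ⊕ (3 · b))
  3a+3b-even = subst EvenZ 2c≡3a+3b (even-2· c)

  2∤3 : ¬ 2 ∣ 3
  2∤3 = from-no (2 ∣? 3)

  b-even⇒a-even : EvenZ b → EvenZ a
  b-even⇒a-even h = even-odd·⁻¹ 2∤3 (even-⊕-cancelʳ (even-·even 3 h) 3a+3b-even)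

  a-even⇒b-even : EvenZ a → EvenZ b
  a-even⇒b-even h = even-odd·⁻¹ 2∤3 (even-⊕-cancelˡ (even-·even 3 h) 3a+3b-even)

  b-even⇒d-even : EvenZ b → EvenZ d
  b-even⇒d-even h = subst EvenZ (sym d≡2a+b) (even-⊕ (even-2· a) h)

  d-even⇒b-even : EvenZ d → EvenZ b
  d-even⇒b-even h = even-⊕-cancelˡ (even-2· a) (subst EvenZ d≡2a+b h)

  a-odd : OddZ a
  a-odd a-even = coprime 2 prime[2] 2∣n a-even b-even c-even (b-even⇒d-even b-even)
    where b-even = a-even⇒b-even a-even

  b-odd : OddZ b
  b-odd = a-odd ∘ b-even⇒a-even

  d-odd : OddZ d
  d-odd = b-odd ∘ d-even⇒b-even
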